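{- Let $D\geq 3$ and let $\mathbf{\mathcal T}$, $\mathcal T$, $X$ be as in the context. Let $L$ be a $\mathbf{\mathcal T}$-submodule of $\mathbb C^{\mathbb F_2^D}$. Then: (i) $L\cap\mathbb C^X$ is a $\mathcal T$-submodule of $\mathbb C^X$; (ii) $L=(L\cap\mathbb C^X)\oplus(L\cap\mathbb C^{\mathbb F_2^D\setminus X})$.
   Context: Let $D\geq 3$ be an integer and $w(y)$ the Hamming weight of $y\in\mathbb F_2^D$. Let $X\subseteq\mathbb F_2^D$ be the set of even-weight vectors, and fix $x\in X$. Let $\mathbf A$ be the adjacency matrix of the hypercube $H(D,2)$ (vertex set $\mathbb F_2^D$, $y,z$ adjacent iff $w(y-z)=1$), and $\mathbf A^*$ the diagonal matrix in $\mathrm{Mat}_{\mathbb F_2^D}(\mathbb C)$ with $\mathbf A^*_{yy}=D-2w(x-y)$. Let $\mathbf{\mathcal T}$ be the subalgebra of $\mathrm{Mat}_{\mathbb F_2^D}(\mathbb C)$ generated by $\mathbf A$ and $\mathbf A^*$, acting on $\mathbb C^{\mathbb F_2^D}$. Let $A$ be the adjacency matrix of the halved cube $\frac12H(D,2)$ (vertex set $X$, $y,z$ adjacent iff $w(y-z)=2$), $A^*$ the diagonal matrix in $\mathrm{Mat}_X(\mathbb C)$ with $A^*_{yy}=D-2w(x-y)$, and $\mathcal T$ the subalgebra of $\mathrm{Mat}_X(\mathbb C)$ generated by $A$ and $A^*$, acting on $\mathbb C^X$. For $Y\subseteq\mathbb F_2^D$, $\mathbb C^Y$ is identified with the subspace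 of $\mathbb C^{\mathbb F_2^D}$ of vectors supported on $Y$. -}

module Defs where

open import Level using (Level; _⊔_) renaming (suc to lsuc)
open import Algebra.Bundles using (CommutativeRing)
open import Data.Bool using (Bool; true; false; if_then_else_; _xor_)
open import Data.Nat using (ℕ; zero; suc; _≡ᵇ_)
open import Data.Nat.Divisibility using (_∣_; _∣?_)
open import Data.Vec using (Vec; []; _∷_; zipWith)
open import Data.List using (List; []; _∷_; map; _++_; foldr)
open import Data.Product using (Σ; ∃; _×_; _,_)
open import Relation.Nullary using (¬_; yes; no)

module RingHelpers {c ℓ : Level} (R : CommutativeRing c ℓ) where
  open CommutativeRing R

  fromℕ : ℕ → Carrier
  fromℕ zero    = 0#
  fromℕ (suc n) = 1# + fromℕ n

  evalMonic : List Carrier → Carrier → Carrier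
  evalMonic []       r = 1#
  evalMonic (a ∷ as) r = a + r * evalMonic as r

-- Algebraically closed fields of characteristic 0 (standing in for ℂ).
record ACF0 (c ℓ : Level) : Set (lsuc (c ⊔ ℓ)) where
  field
    commutativeRing : CommutativeRing c ℓ
  open CommutativeRing commutativeRing
  open RingHelpers commutativeRing
  field
    1≉0       : ¬ (1# ≈ 0#)
    inverse   : ∀ a → ¬ (a ≈ 0#) → ∃ λ b → a * b ≈ 1#
    char0     : ∀ n → ¬ (fromℕ (suc n) ≈ 0#)
    algClosed : ∀ a as → ∃ λ r → evalMonic (a ∷ as) r ≈ 0#
  open CommutativeRing commutativeRing public
  open RingHelpers commutativeRing public

weight : ∀ {n} → Vec Bool n → ℕ
weight []          = 0
weight (true ∷ v)  = suc (weight v)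
weight (false ∷ v) = weight v

_⊕_ : ∀ {n} → Vec Bool n → Vec Bool n → Vec Bool n
_⊕_ = zipWith _xor_

allVecs : (n : ℕ) → List (Vec Bool n)
allVecs zero    = [] ∷ []
allVecs (suc n) = map (true ∷_) (allVecs n) ++ map (false ∷_) (allVecs n)

IsEven : ∀ {n} → Vec Bool n → Set
IsEven v = 2 ∣ weight v

X : ℕ → Set
X D = Σ (Vec Bool D) IsEven

module Cube {c ℓ : Level} (F : ACF0 c ℓ) where
  open ACF0 F

  -- the C-algebra generated by two operators g₁ g₂ (unital; terms of the free algebra)
  data Term : Set c where
    gen₁ gen₂ idₜ : Term
    _+ₜ_ _∘ₜ_     : Term → Term → Term
    _·ₜ_          : Carrier → Term → Term

  module _ {i} {I : Set i} (g₁ g₂ : (I → Carrier) → (I → Carrier)) where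
    eval : Term → (I → Carrier) → (I → Carrier)
    eval gen₁       v = g₁ v
    eval gen₂       v = g₂ v
    eval idₜ        v = v
    eval (s +ₜ t)   v = λ y → eval s v y + eval t v y
    eval (s ∘ₜ t)   v = eval s (eval t v)
    eval (a ·ₜ t)   v = λ y → a * eval t v y

    record IsSubmodule {p} (P : (I → Carrier) → Set p) : Set (c ⊔ ℓ ⊔ i ⊔ p) where
      field
        resp   : ∀ {u v} → (∀ y → u y ≈ v y) → P u → P v
        zero∈  : P (λ _ → 0#)
        +-closed : ∀ {u v} → P u → P v → P (λ y → u y + v y)
        ·-closed : ∀ a {v} → P v → P (λ y → a * v y)
        𝒯-closed : ∀ t {v} → P v → P (eval t v)

  Σ_∈_ : ∀ {A : Set} → List A → (A → Carrier) → Carrier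
  Σ_∈_ zs f = foldr (λ z acc → f z + acc) 0# zs

  𝐀 : (D : ℕ) → (Vec Bool D → Carrier) → (Vec Bool D → Carrier)
  𝐀 D v y = Σ allVecs D ∈ λ z → if weight (y ⊕ z) ≡ᵇ 1 then v z else 0#

  θ* : ∀ {D} → Vec Bool D → Vec Bool D → Carrier
  θ* {D} x y = fromℕ D - fromℕ (weight (x ⊕ y) Data.Nat.+ weight (x ⊕ y))

  𝐀* : ∀ {D} → Vec Bool D → (Vec Bool D → Carrier) → (Vec Bool D → Carrier)
  𝐀* x v y = θ* x y * v y

  -- identification of ℂ^X with vectors on 𝔽₂^D supported on X (extension by zero)
  ext : ∀ {D} → (X D → Carrier) → (Vec Bool D → Carrier)
  ext f y with 2 ∣? weight y
  ... | yes p = f (y , p)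
  ... | no _  = 0#

  Ah : (D : ℕ) → (X D → Carrier) → (X D → Carrier)
  Ah D f (y , _) = Σ allVecs D ∈ λ z → if weight (y ⊕ z) ≡ᵇ 2 then ext f z else 0#

  Ah* : ∀ {D} → Vec Bool D → (X D → Carrier) → (X D → Carrier)
  Ah* x f (y , e) = θ* x y * f (y , e)

  SupportedOn : ∀ {D q} → (Vec Bool D → Set q) → (Vec Bool D → Carrier) → Set (q ⊔ ℓ)
  SupportedOn Y v = ∀ y → ¬ Y y → v y ≈ 0#

  IsDirectSum : ∀ {D p q r} → (L : (Vec Bool D → Carrier) → Set p)
    (M : (Vec Bool D → Carrier) → Set q) (N : (Vec Bool D → Carrier) → Set r) → Set (c ⊔ ℓ ⊔ p ⊔ q ⊔ r)
  IsDirectSum L M N =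
    (∀ v → L v → ∃ λ a → ∃ λ b → M a × N b × (∀ y → v y ≈ a y + b y)) ×
    (∀ a b → M a → N b → L (λ y → a y + b y)) ×
    (∀ u → M u → N u → ∀ y → u y ≈ 0#)

{-# OPTIONS --safe #-}
-- Write S k for the operator summing a vector over the sphere of radius k.  In H(D,2)
-- one has A² = 2 S₂ + D, so S₂ = (A² − D)/2 lies in 𝐓.  The dual adjacency matrix acts
-- on y by D − 2 w(x+y), so by interpolation at the D + 1 points 0, …, D every function
-- of w(x+y) is a polynomial in A*; as x is even, w(x+y) ≡ w(y) (mod 2), so the
-- projection E onto ℂ^X lies in 𝐓.  Then L = E L ⊕ (1 − E) L gives (ii), and
-- (i) holds because the halved cube acts on ℂ^X as E S₂ and its dual as A*.
module Submission where

open import Defs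
open import Level using (_⊔_)
open import Data.Bool using (Bool; true; false; not; if_then_else_; _xor_)
open import Data.Bool.Properties using (not-involutive)
open import Data.Nat using (ℕ; zero; suc; _≤_; _<_; z≤n; s≤s; _≡ᵇ_; parity)
import Data.Nat as ℕ
open import Data.Nat.Properties using (m≤n⇒m≤1+n; m≤n⇒m<n∨m≡n; ≤-pred; <-irrefl; <-trans; n<1+n)
open import Data.Nat.Divisibility using (_∣_; divides; _∣?_)
open import Data.Parity.Base as ℙ using (Parity; 0ℙ; 1ℙ)
open import Data.Parity.Properties using (+-homo-+; *-homo-*; *-zeroʳ)
import Data.Parity.Properties as Parity
open import Algebra.Properties.CommutativeSemigroup Parity.+-commutativeSemigroup
  using () renaming (interchange to ℙ-interchange)
open import Data.Vec using (Vec; []; _∷_)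
open import Data.List using (List; []; _∷_; map; _++_)
open import Data.Product using (_×_; _,_; ∃; proj₁; proj₂)
open import Data.Sum using (inj₁; inj₂)
open import Data.Empty using (⊥-elim)
open import Data.Maybe using (nothing)
open import Relation.Nullary using (¬_; yes; no)
open import Relation.Binary.PropositionalEquality as ≡ using (_≡_; cong; cong₂)
open import Tactic.RingSolver using (solve-∀)
open import Tactic.RingSolver.Core.AlmostCommutativeRing using (AlmostCommutativeRing; fromCommutativeRing)

bitParity : Bool → Parity
bitParity false = 0ℙ
bitParity true  = 1ℙ

bitParity-xor : ∀ b c → bitParity (b xor c) ≡ bitParity b ℙ.+ bitParity c
bitParity-xor false c     = ≡.refl
bitParity-xor true  false = ≡.refl
bitParity-xor true  true  = ≡.refl

parity-weight-∷ : ∀ {n} b (v : Vec Bool n) →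
                  parity (weight (b ∷ v)) ≡ bitParity b ℙ.+ parity (weight v)
parity-weight-∷ false v = ≡.refl
parity-weight-∷ true  v = +-homo-+ 1 (weight v)

parity-weight-⊕ : ∀ {n} (u v : Vec Bool n) →
                  parity (weight (u ⊕ v)) ≡ parity (weight u) ℙ.+ parity (weight v)
parity-weight-⊕ []      []      = ≡.refl
parity-weight-⊕ (b ∷ u) (c ∷ v) = begin
  parity (weight ((b xor c) ∷ (u ⊕ v)))
    ≡⟨ parity-weight-∷ (b xor c) (u ⊕ v) ⟩
  bitParity (b xor c) ℙ.+ parity (weight (u ⊕ v))
    ≡⟨ cong₂ ℙ._+_ (bitParity-xor b c) (parity-weight-⊕ u v) ⟩
  (bitParity b ℙ.+ bitParity c) ℙ.+ (parity (weight u) ℙ.+ parity (weight v))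
    ≡⟨ ℙ-interchange (bitParity b) (bitParity c) (parity (weight u)) (parity (weight v)) ⟩
  (bitParity b ℙ.+ parity (weight u)) ℙ.+ (bitParity c ℙ.+ parity (weight v))
    ≡⟨ ≡.sym (cong₂ ℙ._+_ (parity-weight-∷ b u) (parity-weight-∷ c v)) ⟩
  parity (weight (b ∷ u)) ℙ.+ parity (weight (c ∷ v))
    ∎
  where open ≡.≡-Reasoning

2∣⇒parity≡0ℙ : ∀ {n} → 2 ∣ n → parity n ≡ 0ℙ
2∣⇒parity≡0ℙ (divides q ≡.refl) = ≡.trans (*-homo-* q 2) (*-zeroʳ (parity q))

parity≡0ℙ⇒2∣ : ∀ n → parity n ≡ 0ℙ → 2 ∣ n
parity≡0ℙ⇒2∣ zero          _ = divides 0 ≡.refl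
parity≡0ℙ⇒2∣ (suc (suc n)) p with parity≡0ℙ⇒2∣ n p
... | divides q ≡.refl = divides (suc q) ≡.refl

¬2∣⇒parity≡1ℙ : ∀ n → ¬ 2 ∣ n → parity n ≡ 1ℙ
¬2∣⇒parity≡1ℙ n ¬2∣n with parity n in p
... | 0ℙ = ⊥-elim (¬2∣n (parity≡0ℙ⇒2∣ n p))
... | 1ℙ = ≡.refl

parity-weight-⊕-even : ∀ {n} (u : Vec Bool n) → IsEven u →
                       ∀ v → parity (weight (u ⊕ v)) ≡ parity (weight v)
parity-weight-⊕-even u u-even v =
  ≡.trans (parity-weight-⊕ u v) (cong (ℙ._+ parity (weight v)) (2∣⇒parity≡0ℙ u-even))

IsOdd : ∀ {n} → Vec Bool n → Set
IsOdd v = ¬ IsEven v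

weight≤length : ∀ {n} (v : Vec Bool n) → weight v ≤ n
weight≤length []          = z≤n
weight≤length (true  ∷ v) = s≤s (weight≤length v)
weight≤length (false ∷ v) = m≤n⇒m≤1+n (weight≤length v)

module CommutativeRingIdentities {c ℓ} (F : ACF0 c ℓ) where
  open ACF0 F using (commutativeRing)
  private
    ring : AlmostCommutativeRing c ℓ
    ring = fromCommutativeRing commutativeRing (λ _ → nothing)
  open AlmostCommutativeRing ring

  square-rearrange : ∀ s t u m → (((s + s) + m * u) + t) + (t + u) ≈ ((s + t) + (s + t)) + (u + m * u)
  square-rearrange = solve-∀ ring

module _ {c ℓ} (F : ACF0 c ℓ) where
  open ACF0 F
  open Cube F
  open CommutativeRingIdentities F
  open import Algebra.Properties.CommutativeSemigroup +-commutativeSemigroup using (interchange)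
  open import Relation.Binary.Reasoning.Setoid setoid
  open import Algebra.Properties.Group +-group using (∙-cancelˡ; x∙y⁻¹≈ε⇒x≈y)
  open import Algebra.Properties.AbelianGroup +-abelianGroup using (xyx⁻¹≈y; ⁻¹-anti-homo‿-)
  open import Algebra.Properties.Ring ring using (-1*x≈-x; -‿distribˡ-*)

  x+[y-x]≈y : ∀ a b → a + (b - a) ≈ b
  x+[y-x]≈y a b = trans (sym (+-assoc a b (- a))) (xyx⁻¹≈y a b)

  x-[x-y]≈y : ∀ a b → a - (a - b) ≈ b
  x-[x-y]≈y a b = trans (+-congˡ (⁻¹-anti-homo‿- a b)) (x+[y-x]≈y a b)

  fromℕ-+ : ∀ m n → fromℕ (m ℕ.+ n) ≈ fromℕ m + fromℕ n
  fromℕ-+ zero    n = sym (+-identityˡ _)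
  fromℕ-+ (suc m) n = trans (+-congˡ (fromℕ-+ m n)) (sym (+-assoc _ _ _))

  fromℕ-injective : ∀ m n → fromℕ m ≈ fromℕ n → m ≡ n
  fromℕ-injective zero    zero    _ = ≡.refl
  fromℕ-injective zero    (suc n) e = ⊥-elim (char0 n (sym e))
  fromℕ-injective (suc m) zero    e = ⊥-elim (char0 m e)
  fromℕ-injective (suc m) (suc n) e = cong suc (fromℕ-injective m n (∙-cancelˡ 1# _ _ e))

  fromℕ-difference-≉0 : ∀ {j k} → j < k → ¬ fromℕ k - fromℕ j ≈ 0#
  fromℕ-difference-≉0 {j} {k} j<k e =
    <-irrefl (≡.sym (fromℕ-injective k j (x∙y⁻¹≈ε⇒x≈y _ _ e))) j<k

  *-≉0 : ∀ {a b} → ¬ a ≈ 0# → ¬ b ≈ 0# → ¬ a * b ≈ 0#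
  *-≉0 {a} {b} a≉0 b≉0 ab≈0 with inverse a a≉0
  ... | a⁻¹ , aa⁻¹≈1 = b≉0 (begin
    b              ≈⟨ sym (*-identityˡ b) ⟩
    1# * b         ≈⟨ *-congʳ (trans (sym aa⁻¹≈1) (*-comm a a⁻¹)) ⟩
    (a⁻¹ * a) * b  ≈⟨ *-assoc a⁻¹ a b ⟩
    a⁻¹ * (a * b)  ≈⟨ *-congˡ ab≈0 ⟩
    a⁻¹ * 0#       ≈⟨ zeroʳ a⁻¹ ⟩
    0#             ∎)

  two≉0 : ¬ 1# + 1# ≈ 0#
  two≉0 e = char0 1 (trans (+-congˡ (+-identityʳ 1#)) e)

  ½ : Carrier
  ½ = proj₁ (inverse (1# + 1#) two≉0)

  ½-+ : ∀ a → ½ * (a + a) ≈ a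
  ½-+ a = begin
    ½ * (a + a)              ≈⟨ *-congˡ (+-cong (sym (*-identityˡ a)) (sym (*-identityˡ a))) ⟩
    ½ * (1# * a + 1# * a)    ≈⟨ *-congˡ (sym (distribʳ a 1# 1#)) ⟩
    ½ * ((1# + 1#) * a)      ≈⟨ sym (*-assoc _ _ _) ⟩
    (½ * (1# + 1#)) * a      ≈⟨ *-congʳ (trans (*-comm ½ _) (proj₂ (inverse (1# + 1#) two≉0))) ⟩
    1# * a                   ≈⟨ *-identityˡ a ⟩
    a                        ∎

  data IsPolynomial : (ℕ → Carrier) → Set c where
    const : ∀ a → IsPolynomial (λ _ → a)
    var   : IsPolynomial fromℕ
    _+ₚ_  : ∀ {g h} → IsPolynomial g → IsPolynomial h → IsPolynomial (λ k → g k + h k)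
    _*ₚ_  : ∀ {g h} → IsPolynomial g → IsPolynomial h → IsPolynomial (λ k → g k * h k)

  vanishing : ℕ → ℕ → Carrier
  vanishing zero    k = fromℕ k - fromℕ 0
  vanishing (suc n) k = vanishing n k * (fromℕ k - fromℕ (suc n))

  vanishing-isPolynomial : ∀ n → IsPolynomial (vanishing n)
  vanishing-isPolynomial zero    = var +ₚ const _
  vanishing-isPolynomial (suc n) = vanishing-isPolynomial n *ₚ (var +ₚ const _)

  vanishing-≈0 : ∀ n {k} → k ≤ n → vanishing n k ≈ 0#
  vanishing-≈0 zero    z≤n = -‿inverseʳ _
  vanishing-≈0 (suc n) k≤1+n with m≤n⇒m<n∨m≡n k≤1+n
  ... | inj₁ k<1+n = trans (*-congʳ (vanishing-≈0 n (≤-pred k<1+n))) (zeroˡ _)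
  ... | inj₂ ≡.refl = trans (*-congˡ (-‿inverseʳ _)) (zeroʳ _)

  vanishing-≉0 : ∀ n {k} → n < k → ¬ vanishing n k ≈ 0#
  vanishing-≉0 zero    0<k   = fromℕ-difference-≉0 0<k
  vanishing-≉0 (suc n) 1+n<k =
    *-≉0 (vanishing-≉0 n (<-trans (n<1+n n) 1+n<k)) (fromℕ-difference-≉0 1+n<k)

  -- Newton interpolation: correct the interpolant on 0 … n by a multiple of vanishing n.
  interpolate : ∀ n (φ : ℕ → Carrier) →
                ∃ λ h → IsPolynomial h × (∀ {k} → k ≤ n → h k ≈ φ k)
  interpolate zero    φ = (λ _ → φ 0) , const _ , λ { z≤n → refl }
  interpolate (suc n) φ with interpolate n φ | inverse (vanishing n (suc n)) (vanishing-≉0 n (n<1+n n))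
  ... | h , h-poly , h≈φ | q⁻¹ , qq⁻¹≈1 =
    h′ , h-poly +ₚ (const a *ₚ vanishing-isPolynomial n) , h′≈φ
    where
    a : Carrier
    a = (φ (suc n) - h (suc n)) * q⁻¹
    h′ : ℕ → Carrier
    h′ k = h k + a * vanishing n k
    h′≈φ : ∀ {k} → k ≤ suc n → h′ k ≈ φ k
    h′≈φ k≤1+n with m≤n⇒m<n∨m≡n k≤1+n
    ... | inj₁ k<1+n = begin
      h _ + a * vanishing n _  ≈⟨ +-congˡ (trans (*-congˡ (vanishing-≈0 n (≤-pred k<1+n))) (zeroʳ a)) ⟩
      h _ + 0#                 ≈⟨ +-identityʳ _ ⟩
      h _                      ≈⟨ h≈φ (≤-pred k<1+n) ⟩
      φ _                      ∎
    ... | inj₂ ≡.refl = begin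
      h (suc n) + ((φ (suc n) - h (suc n)) * q⁻¹) * vanishing n (suc n)
        ≈⟨ +-congˡ (*-assoc _ _ _) ⟩
      h (suc n) + (φ (suc n) - h (suc n)) * (q⁻¹ * vanishing n (suc n))
        ≈⟨ +-congˡ (*-congˡ (trans (*-comm _ _) qq⁻¹≈1)) ⟩
      h (suc n) + (φ (suc n) - h (suc n)) * 1#
        ≈⟨ +-congˡ (*-identityʳ _) ⟩
      h (suc n) + (φ (suc n) - h (suc n))
        ≈⟨ x+[y-x]≈y _ _ ⟩
      φ (suc n)
        ∎

  Σ-++ : ∀ {A : Set} (xs ys : List A) f → (Σ xs ++ ys ∈ f) ≈ (Σ xs ∈ f) + (Σ ys ∈ f)
  Σ-++ []       ys f = sym (+-identityˡ _)
  Σ-++ (x ∷ xs) ys f = trans (+-congˡ (Σ-++ xs ys f)) (sym (+-assoc _ _ _))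

  Σ-map : ∀ {A B : Set} (g : A → B) (xs : List A) f → (Σ map g xs ∈ f) ≡ (Σ xs ∈ λ z → f (g z))
  Σ-map g []       f = ≡.refl
  Σ-map g (x ∷ xs) f = cong (f (g x) +_) (Σ-map g xs f)

  Σ-cong : ∀ {A : Set} (xs : List A) {f g} → (∀ z → f z ≈ g z) → (Σ xs ∈ f) ≈ (Σ xs ∈ g)
  Σ-cong []       f≈g = refl
  Σ-cong (x ∷ xs) f≈g = +-cong (f≈g x) (Σ-cong xs f≈g)

  Σ-≈0 : ∀ {A : Set} (xs : List A) {f} → (∀ z → f z ≈ 0#) → (Σ xs ∈ f) ≈ 0#
  Σ-≈0 []       f≈0 = refl
  Σ-≈0 (x ∷ xs) f≈0 = trans (+-cong (f≈0 x) (Σ-≈0 xs f≈0)) (+-identityʳ 0#)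

  Σ-+ : ∀ {A : Set} (xs : List A) f g → (Σ xs ∈ λ z → f z + g z) ≈ (Σ xs ∈ f) + (Σ xs ∈ g)
  Σ-+ []       f g = sym (+-identityʳ 0#)
  Σ-+ (x ∷ xs) f g = trans (+-congˡ (Σ-+ xs f g)) (interchange _ _ _ _)

  Σ-allVecs-suc : ∀ n f → (Σ allVecs (suc n) ∈ f) ≈
                          (Σ allVecs n ∈ λ z → f (true ∷ z)) + (Σ allVecs n ∈ λ z → f (false ∷ z))
  Σ-allVecs-suc n f = trans (Σ-++ (map (true ∷_) (allVecs n)) (map (false ∷_) (allVecs n)) f)
    (reflexive (cong₂ _+_ (Σ-map (true ∷_) (allVecs n) f) (Σ-map (false ∷_) (allVecs n) f)))

  distanceSum : (n : ℕ) → (ℕ → Bool) → (Vec Bool n → Carrier) → Vec Bool n → Carrier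
  distanceSum n P u y = Σ allVecs n ∈ λ z → if P (weight (y ⊕ z)) then u z else 0#

  -- 𝐀 D is definitionally sphereSum D 1, and Ah D f (y , _) is sphereSum D 2 (ext f) y.
  sphereSum : (n k : ℕ) → (Vec Bool n → Carrier) → Vec Bool n → Carrier
  sphereSum n k = distanceSum n (_≡ᵇ k)

  distanceSum-cong : ∀ n P {u v} → (∀ z → u z ≈ v z) →
                     ∀ y → distanceSum n P u y ≈ distanceSum n P v y
  distanceSum-cong n P u≈v y = Σ-cong (allVecs n) (λ z → if-cong (P (weight (y ⊕ z))) (u≈v z))
    where
    if-cong : ∀ b {a a′} → a ≈ a′ → (if b then a else 0#) ≈ (if b then a′ else 0#)
    if-cong true  a≈a′ = a≈a′
    if-cong false _    = refl

  distanceSum-+ : ∀ n P u v y →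
                  distanceSum n P (λ z → u z + v z) y ≈ distanceSum n P u y + distanceSum n P v y
  distanceSum-+ n P u v y =
    trans (Σ-cong (allVecs n) (λ z → if-+ (P (weight (y ⊕ z))) (u z) (v z))) (Σ-+ (allVecs n) _ _)
    where
    if-+ : ∀ b a a′ → (if b then a + a′ else 0#) ≈ (if b then a else 0#) + (if b then a′ else 0#)
    if-+ true  a a′ = refl
    if-+ false a a′ = sym (+-identityʳ 0#)

  -- The first coordinate adds 1 to the distance exactly when it differs from b.
  distanceSum-∷ : ∀ n P u b y →
    distanceSum (suc n) P u (b ∷ y) ≈
    distanceSum n P (λ z → u (b ∷ z)) y + distanceSum n (λ w → P (suc w)) (λ z → u (not b ∷ z)) y
  distanceSum-∷ n P u true  y = Σ-allVecs-suc n _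
  distanceSum-∷ n P u false y = trans (Σ-allVecs-suc n _) (+-comm _ _)

  sphereSum-zero : ∀ n u y → sphereSum n 0 u y ≈ u y
  sphereSum-zero zero    u []      = +-identityʳ _
  sphereSum-zero (suc n) u (b ∷ y) = begin
    sphereSum (suc n) 0 u (b ∷ y)
      ≈⟨ distanceSum-∷ n (_≡ᵇ 0) u b y ⟩
    sphereSum n 0 (λ z → u (b ∷ z)) y + distanceSum n (λ _ → false) (λ z → u (not b ∷ z)) y
      ≈⟨ +-cong (sphereSum-zero n _ y) (Σ-≈0 (allVecs n) (λ _ → refl)) ⟩
    u (b ∷ y) + 0#
      ≈⟨ +-identityʳ _ ⟩
    u (b ∷ y)
      ∎

  sphereSum-square : ∀ n u y →
    sphereSum n 1 (sphereSum n 1 u) y ≈ (sphereSum n 2 u y + sphereSum n 2 u y) + fromℕ n * u y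
  sphereSum-square zero    u [] = begin
    0# + 0#                              ≈⟨ sym (+-congʳ (+-identityʳ 0#)) ⟩
    (0# + 0#) + 0#                       ≈⟨ sym (+-cong (+-cong (+-identityʳ _) (+-identityʳ _)) (zeroˡ _)) ⟩
    ((0# + 0#) + (0# + 0#)) + 0# * u []  ∎
  sphereSum-square (suc n) u (b ∷ y) = begin
    S (suc n) 1 (S (suc n) 1 u) (b ∷ y)
      ≈⟨ distanceSum-∷ n (_≡ᵇ 1) _ b y ⟩
    S n 1 (λ z → S (suc n) 1 u (b ∷ z)) y + S n 0 (λ z → S (suc n) 1 u (not b ∷ z)) y
      ≈⟨ +-cong (distanceSum-cong n (_≡ᵇ 1) (λ z → distanceSum-∷ n (_≡ᵇ 1) u b z) y)
                (distanceSum-cong n (_≡ᵇ 0) (λ z → split-not z) y) ⟩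
    S n 1 (λ z → S n 1 u₌ z + S n 0 u≠ z) y + S n 0 (λ z → S n 1 u≠ z + S n 0 u₌ z) y
      ≈⟨ +-cong (distanceSum-+ n (_≡ᵇ 1) _ _ y) (distanceSum-+ n (_≡ᵇ 0) _ _ y) ⟩
    (S n 1 (S n 1 u₌) y + S n 1 (S n 0 u≠) y) + (S n 0 (S n 1 u≠) y + S n 0 (S n 0 u₌) y)
      ≈⟨ +-cong (+-cong (sphereSum-square n u₌ y) (distanceSum-cong n (_≡ᵇ 1) (sphereSum-zero n u≠) y))
                (+-cong (sphereSum-zero n _ y) (trans (sphereSum-zero n _ y) (sphereSum-zero n u₌ y))) ⟩
    (((S n 2 u₌ y + S n 2 u₌ y) + fromℕ n * u₌ y) + S n 1 u≠ y) + (S n 1 u≠ y + u₌ y)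
      ≈⟨ square-rearrange _ _ _ _ ⟩
    ((S n 2 u₌ y + S n 1 u≠ y) + (S n 2 u₌ y + S n 1 u≠ y)) + (u₌ y + fromℕ n * u₌ y)
      ≈⟨ +-congˡ (sym (trans (distribʳ _ _ _) (+-congʳ (*-identityˡ _)))) ⟩
    ((S n 2 u₌ y + S n 1 u≠ y) + (S n 2 u₌ y + S n 1 u≠ y)) + fromℕ (suc n) * u (b ∷ y)
      ≈⟨ +-congʳ (sym (+-cong (distanceSum-∷ n (_≡ᵇ 2) u b y) (distanceSum-∷ n (_≡ᵇ 2) u b y))) ⟩
    (S (suc n) 2 u (b ∷ y) + S (suc n) 2 u (b ∷ y)) + fromℕ (suc n) * u (b ∷ y)
      ∎
    where
    S : (m k : ℕ) → (Vec Bool m → Carrier) → Vec Bool m → Carrier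
    S = sphereSum
    u₌ u≠ : Vec Bool n → Carrier
    u₌ z = u (b ∷ z)
    u≠ z = u (not b ∷ z)
    split-not : ∀ z → S (suc n) 1 u (not b ∷ z) ≈ S n 1 u≠ z + S n 0 u₌ z
    split-not z with distanceSum-∷ n (_≡ᵇ 1) u (not b) z
    ... | split rewrite not-involutive b = split

  evenIndicator oddIndicator : Parity → Carrier
  evenIndicator 0ℙ = 1#
  evenIndicator 1ℙ = 0#
  oddIndicator  0ℙ = 0#
  oddIndicator  1ℙ = 1#

  indicators-partition : ∀ p a → a ≈ evenIndicator p * a + oddIndicator p * a
  indicators-partition 0ℙ a = sym (trans (+-cong (*-identityˡ a) (zeroˡ a)) (+-identityʳ a))
  indicators-partition 1ℙ a = sym (trans (+-cong (zeroˡ a) (*-identityˡ a)) (+-identityˡ a))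

  module _ {D : ℕ} where

    evenPart-supportedOn : ∀ (v : Vec Bool D → Carrier) →
                           SupportedOn IsEven (λ y → evenIndicator (parity (weight y)) * v y)
    evenPart-supportedOn v y y-odd rewrite ¬2∣⇒parity≡1ℙ (weight y) y-odd = zeroˡ (v y)

    oddPart-supportedOn : ∀ (v : Vec Bool D → Carrier) →
                          SupportedOn IsOdd (λ y → oddIndicator (parity (weight y)) * v y)
    oddPart-supportedOn v y ¬y-odd with 2 ∣? weight y
    ... | yes y-even rewrite 2∣⇒parity≡0ℙ y-even = zeroˡ (v y)
    ... | no  y-odd  = ⊥-elim (¬y-odd y-odd)

    supportedOn-even-odd⇒≈0 : ∀ {u : Vec Bool D → Carrier} →
                              SupportedOn IsEven u → SupportedOn IsOdd u → ∀ y → u y ≈ 0#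
    supportedOn-even-odd⇒≈0 u-even u-odd y with 2 ∣? weight y
    ... | yes y-even = u-odd y (λ y-odd → y-odd y-even)
    ... | no  y-odd  = u-even y y-odd

    ext-cong : ∀ {f g : X D → Carrier} → (∀ z → f z ≈ g z) → ∀ y → ext f y ≈ ext g y
    ext-cong f≈g y with 2 ∣? weight y
    ... | yes y-even = f≈g (y , y-even)
    ... | no  _      = refl

    ext-0 : ∀ y → ext {D} (λ _ → 0#) y ≈ 0#
    ext-0 y with 2 ∣? weight y
    ... | yes _ = refl
    ... | no  _ = refl

    ext-+ : ∀ (f g : X D → Carrier) y → ext (λ z → f z + g z) y ≈ ext f y + ext g y
    ext-+ f g y with 2 ∣? weight y
    ... | yes _ = refl
    ... | no  _ = sym (+-identityʳ 0#)

    ext-scale : ∀ (g : Vec Bool D → Carrier) (f : X D → Carrier) y →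
                ext (λ z → g (proj₁ z) * f z) y ≈ g y * ext f y
    ext-scale g f y with 2 ∣? weight y
    ... | yes _ = refl
    ... | no  _ = sym (zeroʳ (g y))

    ext-restrict : ∀ (u : Vec Bool D → Carrier) y →
                   ext (λ z → u (proj₁ z)) y ≈ evenIndicator (parity (weight y)) * u y
    ext-restrict u y with 2 ∣? weight y
    ... | yes y-even rewrite 2∣⇒parity≡0ℙ y-even = sym (*-identityˡ (u y))
    ... | no  y-odd  rewrite ¬2∣⇒parity≡1ℙ (weight y) y-odd = sym (zeroˡ (u y))

  module _ {D : ℕ} (x : Vec Bool D) {p} {L : (Vec Bool D → Carrier) → Set p}
           (L-sub : IsSubmodule (𝐀 D) (𝐀* x) L) where
    open IsSubmodule L-sub

    Multiplier : (Vec Bool D → Carrier) → Set (c ⊔ p)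
    Multiplier g = ∀ {v} → L v → L (λ y → g y * v y)

    Multiplier-resp : ∀ {g h} → (∀ y → g y ≈ h y) → Multiplier g → Multiplier h
    Multiplier-resp g≈h g-mult Lv = resp (λ y → *-congʳ (g≈h y)) (g-mult Lv)

    const-Multiplier : ∀ a → Multiplier (λ _ → a)
    const-Multiplier = ·-closed

    +-Multiplier : ∀ {g h} → Multiplier g → Multiplier h → Multiplier (λ y → g y + h y)
    +-Multiplier g-mult h-mult Lv = resp (λ y → sym (distribʳ _ _ _)) (+-closed (g-mult Lv) (h-mult Lv))

    *-Multiplier : ∀ {g h} → Multiplier g → Multiplier h → Multiplier (λ y → g y * h y)
    *-Multiplier g-mult h-mult Lv = resp (λ y → sym (*-assoc _ _ _)) (g-mult (h-mult Lv))

    -- w(x + y) = ½ (D − θ*(y))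
    distance-Multiplier : Multiplier (λ y → fromℕ (weight (x ⊕ y)))
    distance-Multiplier = Multiplier-resp ½[D-θ*]≈w
      (*-Multiplier (const-Multiplier ½)
        (+-Multiplier (const-Multiplier (fromℕ D)) (*-Multiplier (const-Multiplier (- 1#)) (𝒯-closed gen₂))))
      where
      ½[D-θ*]≈w : ∀ y → ½ * (fromℕ D + - 1# * θ* x y) ≈ fromℕ (weight (x ⊕ y))
      ½[D-θ*]≈w y = let w = weight (x ⊕ y) in begin
        ½ * (fromℕ D + - 1# * θ* x y)         ≈⟨ *-congˡ (+-congˡ (-1*x≈-x _)) ⟩
        ½ * (fromℕ D - θ* x y)                ≈⟨ *-congˡ (x-[x-y]≈y _ _) ⟩
        ½ * fromℕ (w ℕ.+ w)                   ≈⟨ *-congˡ (fromℕ-+ w w) ⟩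
        ½ * (fromℕ w + fromℕ w)               ≈⟨ ½-+ (fromℕ w) ⟩
        fromℕ w                               ∎

    polynomial-Multiplier : ∀ {h} → IsPolynomial h → Multiplier (λ y → h (weight (x ⊕ y)))
    polynomial-Multiplier (const a) = const-Multiplier a
    polynomial-Multiplier var       = distance-Multiplier
    polynomial-Multiplier (g +ₚ h)  = +-Multiplier (polynomial-Multiplier g) (polynomial-Multiplier h)
    polynomial-Multiplier (g *ₚ h)  = *-Multiplier (polynomial-Multiplier g) (polynomial-Multiplier h)

    parity-Multiplier : IsEven x → ∀ (g : Parity → Carrier) → Multiplier (λ y → g (parity (weight y)))
    parity-Multiplier x-even g with interpolate D (λ k → g (parity k))
    ... | h , h-poly , h≈g = Multiplier-resp h≈g∘parity (polynomial-Multiplier h-poly)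
      where
      h≈g∘parity : ∀ y → h (weight (x ⊕ y)) ≈ g (parity (weight y))
      h≈g∘parity y = trans (h≈g (weight≤length (x ⊕ y)))
                           (reflexive (cong g (parity-weight-⊕-even x x-even y)))

    sphereSum₂-closed : ∀ {u} → L u → L (sphereSum D 2 u)
    sphereSum₂-closed {u} Lu =
      resp ½[A²-D]≈S₂
        (·-closed ½ (+-closed (𝒯-closed (gen₁ ∘ₜ gen₁) Lu) (·-closed (- fromℕ D) Lu)))
      where
      ½[A²-D]≈S₂ : ∀ y → ½ * (sphereSum D 1 (sphereSum D 1 u) y + - fromℕ D * u y) ≈ sphereSum D 2 u y
      ½[A²-D]≈S₂ y = begin
        ½ * (sphereSum D 1 (sphereSum D 1 u) y + - fromℕ D * u y)
          ≈⟨ *-congˡ (+-cong (sphereSum-square D u y) (sym (-‿distribˡ-* (fromℕ D) (u y)))) ⟩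
        ½ * (((sphereSum D 2 u y + sphereSum D 2 u y) + fromℕ D * u y) - fromℕ D * u y)
          ≈⟨ *-congˡ (trans (+-assoc _ _ _) (trans (+-congˡ (-‿inverseʳ _)) (+-identityʳ _))) ⟩
        ½ * (sphereSum D 2 u y + sphereSum D 2 u y)
          ≈⟨ ½-+ _ ⟩
        sphereSum D 2 u y
          ∎

    restriction-isSubmodule : IsEven x → IsSubmodule (Ah D) (Ah* x) (λ f → L (ext f))
    restriction-isSubmodule x-even = record
      { resp     = λ f≈g Lf → resp (ext-cong f≈g) Lf
      ; zero∈    = resp (λ y → sym (ext-0 y)) zero∈
      ; +-closed = λ Lf Lg → resp (λ y → sym (ext-+ _ _ y)) (+-closed Lf Lg)
      ; ·-closed = λ a Lf → resp (λ y → sym (ext-scale (λ _ → a) _ y)) (·-closed a Lf)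
      ; 𝒯-closed = 𝒯-closed′
      }
      where
      𝒯-closed′ : ∀ t {f} → L (ext f) → L (ext (eval (Ah D) (Ah* x) t f))
      𝒯-closed′ gen₁     {f} Lf = resp (λ y → sym (ext-restrict (sphereSum D 2 (ext f)) y))
                                        (parity-Multiplier x-even evenIndicator (sphereSum₂-closed Lf))
      𝒯-closed′ gen₂     {f} Lf = resp (λ y → sym (ext-scale (θ* x) f y)) (𝒯-closed gen₂ Lf)
      𝒯-closed′ idₜ          Lf = Lf
      𝒯-closed′ (s +ₜ t)     Lf =
        resp (λ y → sym (ext-+ _ _ y)) (+-closed (𝒯-closed′ s Lf) (𝒯-closed′ t Lf))
      𝒯-closed′ (s ∘ₜ t)     Lf = 𝒯-closed′ s (𝒯-closed′ t Lf)
      𝒯-closed′ (a ·ₜ t)     Lf =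
        resp (λ y → sym (ext-scale (λ _ → a) _ y)) (·-closed a (𝒯-closed′ t Lf))

    parity-isDirectSum : IsEven x →
      IsDirectSum L (λ v → L v × SupportedOn IsEven v) (λ v → L v × SupportedOn IsOdd v)
    parity-isDirectSum x-even = decompose , (λ _ _ (La , _) (Lb , _) → +-closed La Lb) ,
                                (λ u (_ , u-even) (_ , u-odd) → supportedOn-even-odd⇒≈0 u-even u-odd)
      where
      decompose : ∀ v → L v → ∃ λ a → ∃ λ b → (L a × SupportedOn IsEven a) × (L b × SupportedOn IsOdd b)
                                               × (∀ y → v y ≈ a y + b y)
      decompose v Lv =
        _ , _ , (parity-Multiplier x-even evenIndicator Lv , evenPart-supportedOn v)
              , (parity-Multiplier x-even oddIndicator Lv , oddPart-supportedOn v)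
              , (λ y → indicators-partition (parity (weight y)) (v y))

lemma5p1 : ∀ {c ℓ p} (F : ACF0 c ℓ) → let open ACF0 F in let open Cube F in
    (D : ℕ) → 3 ≤ D → (x : Vec Bool D) → IsEven x →
    (L : (Vec Bool D → Carrier) → Set p) →
    IsSubmodule (𝐀 D) (𝐀* x) L →
    IsSubmodule (Ah D) (Ah* x) (λ f → L (ext f))
    × IsDirectSum L (λ v → L v × SupportedOn IsEven v)
                    (λ v → L v × SupportedOn (λ y → ¬ IsEven y) v)
lemma5p1 F D _ x x-even L L-sub =
  restriction-isSubmodule F x L-sub x-even , parity-isDirectSum F x L-sub x-even
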